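{- Let $q$ be a prime power, $m\ge n$, $Q=q^m$. Let $C\subseteq\mathbb F_q^n$ be an $\mathbb F_q$-linear code with minimum Hamming distance $d$. Then for any $\boldsymbol\alpha\in(\mathbb F_Q^{*})^n$, the minimum Hamming distance of the $\mathbb F_Q$-linear code $\mathcal C(C,\boldsymbol\alpha)$ is equal to $d$.
   Context: For $\boldsymbol\alpha=(\alpha_1,\dots,\alpha_n)\in\mathbb F_Q^n$, let $\psi_{\boldsymbol\alpha}:\mathbb F_q^n\to\mathbb F_Q^n$, $(x_1,\dots,x_n)\mapsto(x_1\alpha_1,\dots,x_n\alpha_n)$. For an $\mathbb F_q$-linear code $C\subseteq\mathbb F_q^n$, $\mathcal C(C,\boldsymbol\alpha)$ denotes the $\mathbb F_Q$-linear span of $\psi_{\boldsymbol\alpha}(C)$. -}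

module Defs where

open import Data.Nat using (ℕ; _≤_)
open import Data.Fin using (Fin)
open import Data.Vec using (Vec; zipWith; replicate; count)
import Data.Vec
open import Data.Product using (∃; _×_; Σ)
open import Relation.Nullary using (¬_; ¬?)
open import Relation.Binary using (DecidableEquality)
open import Relation.Binary.PropositionalEquality using (_≡_; _≢_)
open import Algebra.Structures using (IsCommutativeRing)
open import Function.Bundles using (_↔_)

record FiniteField (q : ℕ) : Set₁ where
  infixl 6 _+_
  infixl 7 _*_
  field
    Carrier : Set
    _+_ _*_ : Carrier → Carrier → Carrier
    -_      : Carrier → Carrier
    0# 1#   : Carrier
    isCommutativeRing : IsCommutativeRing _≡_ _+_ _*_ -_ 0# 1#
    0≢1     : 0# ≢ 1#
    inverse : ∀ x → x ≢ 0# → ∃ λ y → x * y ≡ 1#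
    _≟_     : DecidableEquality Carrier
    enumeration : Carrier ↔ Fin q

open FiniteField

record IsFieldHom {q Q : ℕ} (F : FiniteField q) (K : FiniteField Q)
                  (ι : Carrier F → Carrier K) : Set where
  field
    +-hom : ∀ x y → ι (_+_ F x y) ≡ _+_ K (ι x) (ι y)
    *-hom : ∀ x y → ι (_*_ F x y) ≡ _*_ K (ι x) (ι y)
    1-hom : ι (1# F) ≡ 1# K

Word : ∀ {q} → FiniteField q → ℕ → Set
Word F n = Vec (Carrier F) n

zeroWord : ∀ {q} (F : FiniteField q) n → Word F n
zeroWord F n = replicate n (0# F)

weight : ∀ {q} (F : FiniteField q) {n} → Word F n → ℕ
weight F = count (λ x → ¬? (_≟_ F x (0# F)))

record LinearCode {q} (F : FiniteField q) (n : ℕ) : Set₁ where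
  field
    _∈C : Word F n → Set
    zero-∈ : zeroWord F n ∈C
    add-∈  : ∀ {u v} → u ∈C → v ∈C → zipWith (_+_ F) u v ∈C
    scale-∈ : ∀ (a : Carrier F) {u} → u ∈C → Data.Vec.map (_*_ F a) u ∈C

MinDist : ∀ {q} (F : FiniteField q) {n} → (Word F n → Set) → ℕ → Set
MinDist F {n} S d =
  (∃ λ c → S c × c ≢ zeroWord F n × weight F c ≡ d) ×
  (∀ c → S c → c ≢ zeroWord F n → d ≤ weight F c)

data Span {q} (F : FiniteField q) {n} (S : Word F n → Set) : Word F n → Set where
  span-zero  : Span F S (zeroWord F n)
  span-gen   : ∀ {v} → S v → Span F S v
  span-add   : ∀ {u v} → Span F S u → Span F S v → Span F S (zipWith (_+_ F) u v)
  span-scale : ∀ a {u} → Span F S u → Span F S (Data.Vec.map (_*_ F a) u)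

ψ : ∀ {q Q} (F : FiniteField q) (K : FiniteField Q) (ι : Carrier F → Carrier K)
    {n} → Word K n → Word F n → Word K n
ψ F K ι α x = zipWith (λ xi ai → _*_ K (ι xi) ai) x α

𝒞 : ∀ {q Q} (F : FiniteField q) (K : FiniteField Q) (ι : Carrier F → Carrier K)
    {n} → LinearCode F n → Word K n → Word K n → Set
𝒞 F K ι C α = Span K (λ y → ∃ λ c → LinearCode._∈C C c × y ≡ ψ F K ι α c)

-- A word of 𝒞(C, α) has coordinates wᵢ = (Σⱼ λⱼ ι(cⱼᵢ)) αᵢ with cⱼ ∈ C and λⱼ ∈ K.
-- Since F is finite, F-linear dependence among the λⱼ is decidable, and Gaussian
-- elimination (adding F-multiples of one cⱼ to the others, which stays inside C)
-- makes the λⱼ linearly independent over F.  Then wᵢ = 0 forces cⱼᵢ = 0 for all j,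
-- so a nonzero w has the support of some nonzero cⱼ inside its own and weight ≥ d.
-- The bound is attained because ψ_α preserves weights when every αᵢ ≠ 0.

module Submission where

open import Defs
open import Data.Nat using (ℕ; _≤_; _^_)
open import Data.Nat.Primality using (Prime)
open import Data.Vec using (Vec)
open import Data.Vec.Relation.Unary.All using (All)
open import Relation.Binary.PropositionalEquality using (_≡_; _≢_)

open import Algebra.Bundles using (CommutativeRing)
import Algebra.Properties.Group as GroupProperties
import Algebra.Solver.Ring.NaturalCoefficients.Default as SemiringSolver
open import Data.Empty using (⊥-elim)
open import Data.Fin using (Fin; zero; suc)
open import Data.Fin.Properties using (any?)
import Data.Nat as Nat
open import Data.Nat using (z≤n; s≤s)
open import Data.Nat.Properties using (m≤n⇒m≤1+n; ≤-antisym; ≤-trans)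
open import Data.Product using (∃; _×_; _,_)
open import Data.Sum using (_⊎_; inj₁; inj₂)
open import Data.Vec using ([]; _∷_; _++_; lookup; map; zipWith; count)
open import Data.Vec.Properties using (lookup-map; lookup-zipWith; lookup-replicate; map-++; ≡-dec)
open import Data.Vec.Relation.Binary.Pointwise.Extensional using (ext; Pointwise-≡⇒≡)
open import Data.Vec.Relation.Unary.All using ([]; _∷_; lookupAny)
import Data.Vec.Relation.Unary.All as All
open import Data.Vec.Relation.Unary.All.Properties using (lookup⁺; ++⁺; map⁺)
open import Data.Vec.Relation.Unary.Any using (Any; here; there)
import Data.Vec.Relation.Unary.Any as Any
open import Function using (_∘_; _↔_; Inverse)
open import Relation.Nullary using (Dec; yes; no; ¬_)
open import Relation.Unary using (Pred; Decidable)
open import Relation.Binary.PropositionalEquality using (refl; sym; trans; cong; cong₂; subst; module ≡-Reasoning)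

module _ {a b p r} {A : Set a} {B : Set b} {P : Pred A p} {R : Pred B r}
         (P? : Decidable P) (R? : Decidable R) where

  count-mono : ∀ {n} (xs : Vec A n) (ys : Vec B n) →
               (∀ i → P (lookup xs i) → R (lookup ys i)) → count P? xs ≤ count R? ys
  count-mono []       []       _   = z≤n
  count-mono (x ∷ xs) (y ∷ ys) P⇒R with P? x | R? y | count-mono xs ys (P⇒R ∘ suc)
  ... | yes _  | yes _ | ih = s≤s ih
  ... | yes px | no ¬ry | _ = ⊥-elim (¬ry (P⇒R zero px))
  ... | no _   | yes _ | ih = m≤n⇒m≤1+n ih
  ... | no _   | no _  | ih = ih

module _ {a p} {A : Set a} {P : Pred A p} (P? : Decidable P) where

  all⊎any¬ : ∀ {n} (xs : Vec A n) → All P xs ⊎ Any (¬_ ∘ P) xs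
  all⊎any¬ []       = inj₁ []
  all⊎any¬ (x ∷ xs) with P? x | all⊎any¬ xs
  ... | no ¬px | _       = inj₂ (here ¬px)
  ... | yes px | inj₁ ps = inj₁ (px ∷ ps)
  ... | yes _  | inj₂ ¬p = inj₂ (there ¬p)

module _ {a} {A : Set a} {q} (enumeration : A ↔ Fin q) where

  ∃?-finite : ∀ {p} {P : Pred A p} → Decidable P → Dec (∃ P)
  ∃?-finite {P = P} P? with any? (P? ∘ Inverse.from enumeration)
  ... | yes (_ , p) = yes (_ , p)
  ... | no ∄        = no λ (x , px) →
    ∄ (Inverse.to enumeration x , subst P (sym (Inverse.strictlyInverseʳ enumeration x)) px)

  ∃?-finiteVec : ∀ {p} k {P : Pred (Vec A k) p} → Decidable P → Dec (∃ P)
  ∃?-finiteVec Nat.zero    P? with P? []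
  ... | yes p = yes (_ , p)
  ... | no ¬p = no λ { ([] , p) → ¬p p }
  ∃?-finiteVec (Nat.suc k) P? with ∃?-finite (λ x → ∃?-finiteVec k (P? ∘ (x ∷_)))
  ... | yes (_ , _ , p) = yes (_ , p)
  ... | no ∄            = no λ { ((x ∷ xs) , p) → ∄ (x , xs , p) }

module _ {q Q} (F : FiniteField q) (K : FiniteField Q) where
  open FiniteField using (0#)

  weight-mono : ∀ {n} (u : Word F n) (v : Word K n) →
                (∀ i → lookup v i ≡ 0# K → lookup u i ≡ 0# F) → weight F u ≤ weight K v
  weight-mono u v zeros = count-mono _ _ u v (λ i uᵢ≢0 vᵢ≡0 → uᵢ≢0 (zeros i vᵢ≡0))

  zeroWord-mono : ∀ {n} (u : Word F n) (v : Word K n) →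
                  (∀ i → lookup v i ≡ 0# K → lookup u i ≡ 0# F) → v ≡ zeroWord K n → u ≡ zeroWord F n
  zeroWord-mono u v zeros refl = Pointwise-≡⇒≡ (ext λ i →
    trans (zeros i (lookup-replicate i (0# K))) (sym (lookup-replicate i (0# F))))

module FiniteFieldProperties {q} (F : FiniteField q) where
  open FiniteField F

  commutativeRing : CommutativeRing _ _
  commutativeRing = record { isCommutativeRing = isCommutativeRing }

  open CommutativeRing commutativeRing using (*-assoc; *-identityʳ; zeroˡ)
  open ≡-Reasoning

  x*y≡0⇒x≡0 : ∀ {x y} → y ≢ 0# → x * y ≡ 0# → x ≡ 0#
  x*y≡0⇒x≡0 {x} {y} y≢0 xy≡0 with inverse y y≢0
  ... | y⁻¹ , yy⁻¹≡1 = begin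
    x              ≡⟨ sym (*-identityʳ x) ⟩
    x * 1#         ≡⟨ cong (x *_) yy⁻¹≡1 ⟨
    x * (y * y⁻¹)  ≡⟨ *-assoc x y y⁻¹ ⟨
    x * y * y⁻¹    ≡⟨ cong (_* y⁻¹) xy≡0 ⟩
    0# * y⁻¹       ≡⟨ zeroˡ y⁻¹ ⟩
    0#             ∎

module FieldHomProperties {q Q} {F : FiniteField q} {K : FiniteField Q}
                          {ι : FiniteField.Carrier F → FiniteField.Carrier K}
                          (hom : IsFieldHom F K ι) where
  private
    module F = FiniteField F
    module FR = CommutativeRing (FiniteFieldProperties.commutativeRing F)
    module KR = CommutativeRing (FiniteFieldProperties.commutativeRing K)
  open FiniteField K
  open IsFieldHom hom
  open ≡-Reasoning

  ι-0# : ι F.0# ≡ 0#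
  ι-0# = GroupProperties.identityˡ-unique KR.+-group (ι F.0#) (ι F.0#) (begin
    ι F.0# + ι F.0#  ≡⟨ +-hom F.0# F.0# ⟨
    ι (F.0# F.+ F.0#) ≡⟨ cong ι (FR.+-identityʳ F.0#) ⟩
    ι F.0#           ∎)

  ι-nonzero : ∀ {x} → x ≢ F.0# → ι x ≢ 0#
  ι-nonzero {x} x≢0 ιx≡0 with F.inverse x x≢0
  ... | x⁻¹ , xx⁻¹≡1 = 0≢1 (begin
    0#              ≡⟨ KR.zeroˡ (ι x⁻¹) ⟨
    0# * ι x⁻¹      ≡⟨ cong (_* ι x⁻¹) ιx≡0 ⟨
    ι x * ι x⁻¹     ≡⟨ *-hom x x⁻¹ ⟨
    ι (x F.* x⁻¹)   ≡⟨ cong ι xx⁻¹≡1 ⟩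
    ι F.1#          ≡⟨ 1-hom ⟩
    1#              ∎)

module LinearCombinations {q Q} {F : FiniteField q} {K : FiniteField Q}
                          {ι : FiniteField.Carrier F → FiniteField.Carrier K}
                          (hom : IsFieldHom F K ι) where
  private
    module F = FiniteField F
    module FR = CommutativeRing (FiniteFieldProperties.commutativeRing F)
    module KR = CommutativeRing (FiniteFieldProperties.commutativeRing K)
  open FiniteField K
  open FiniteFieldProperties K using (commutativeRing; x*y≡0⇒x≡0)
  open FieldHomProperties hom using (ι-0#; ι-nonzero)
  open IsFieldHom hom
  open SemiringSolver (CommutativeRing.commutativeSemiring commutativeRing)
  open ≡-Reasoning

  linComb : ∀ {k} → Vec Carrier k → Vec F.Carrier k → Carrier
  linComb []       []       = 0#
  linComb (l ∷ ls) (f ∷ fs) = ι f * l + linComb ls fs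

  linComb-zeros : ∀ {k} (ls : Vec Carrier k) {fs} → All (_≡ F.0#) fs → linComb ls fs ≡ 0#
  linComb-zeros []       []           = refl
  linComb-zeros (l ∷ ls) (refl ∷ fs≡0) = begin
    ι F.0# * l + linComb ls _ ≡⟨ cong₂ (λ x y → x * l + y) ι-0# (linComb-zeros ls fs≡0) ⟩
    0# * l + 0#               ≡⟨ solve 1 (λ x → con 0 :* x :+ con 0 := con 0) refl l ⟩
    0#                        ∎

  linComb-++ : ∀ {k k′} (ls : Vec Carrier k) (ls′ : Vec Carrier k′) fs fs′ →
               linComb (ls ++ ls′) (fs ++ fs′) ≡ linComb ls fs + linComb ls′ fs′
  linComb-++ []       ls′ []       fs′ = sym (KR.+-identityˡ _)
  linComb-++ (l ∷ ls) ls′ (f ∷ fs) fs′ =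
    trans (cong (ι f * l +_) (linComb-++ ls ls′ fs fs′)) (sym (KR.+-assoc _ _ _))

  linComb-map-*ˡ : ∀ {k} a (ls : Vec Carrier k) fs → linComb (map (a *_) ls) fs ≡ a * linComb ls fs
  linComb-map-*ˡ a []       []       = sym (KR.zeroʳ a)
  linComb-map-*ˡ a (l ∷ ls) (f ∷ fs) = begin
    ι f * (a * l) + linComb (map (a *_) ls) fs ≡⟨ cong (ι f * (a * l) +_) (linComb-map-*ˡ a ls fs) ⟩
    ι f * (a * l) + a * linComb ls fs
      ≡⟨ solve 4 (λ x y z w → x :* (y :* z) :+ y :* w := y :* (x :* z :+ w)) refl (ι f) a l (linComb ls fs) ⟩
    a * (ι f * l + linComb ls fs)              ∎

  linComb-map-*ʳ : ∀ {k} h (ls : Vec Carrier k) fs → linComb ls (map (h F.*_) fs) ≡ ι h * linComb ls fs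
  linComb-map-*ʳ h []       []       = sym (KR.zeroʳ _)
  linComb-map-*ʳ h (l ∷ ls) (f ∷ fs) = begin
    ι (h F.* f) * l + linComb ls (map (h F.*_) fs)
      ≡⟨ cong₂ _+_ (cong (_* l) (*-hom h f)) (linComb-map-*ʳ h ls fs) ⟩
    ι h * ι f * l + ι h * linComb ls fs
      ≡⟨ solve 4 (λ x y z w → x :* y :* z :+ x :* w := x :* (y :* z :+ w)) refl (ι h) (ι f) l (linComb ls fs) ⟩
    ι h * (ι f * l + linComb ls fs)     ∎

  linComb-axpy : ∀ {k} x (ls : Vec Carrier k) fs gs →
    linComb ls (zipWith (λ f g → f F.+ g F.* x) fs gs) ≡ linComb ls fs + ι x * linComb ls gs
  linComb-axpy x []       []       []       = sym (trans (cong (0# +_) (KR.zeroʳ (ι x))) (KR.+-identityʳ 0#))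
  linComb-axpy x (l ∷ ls) (f ∷ fs) (g ∷ gs) = begin
    ι (f F.+ g F.* x) * l + linComb ls (zipWith (λ f g → f F.+ g F.* x) fs gs)
      ≡⟨ cong₂ _+_ (cong (_* l) (trans (+-hom _ _) (cong (ι f +_) (*-hom g x)))) (linComb-axpy x ls fs gs) ⟩
    (ι f + ι g * ι x) * l + (linComb ls fs + ι x * linComb ls gs)
      ≡⟨ solve 6 (λ a b c d e u → (a :+ b :* c) :* d :+ (e :+ c :* u) := a :* d :+ e :+ c :* (b :* d :+ u))
               refl (ι f) (ι g) (ι x) l (linComb ls fs) (linComb ls gs) ⟩
    ι f * l + linComb ls fs + ι x * (ι g * l + linComb ls gs) ∎

  infix 4 _∈F-span_ _∈F-span?_

  _∈F-span_ : ∀ {k} → Carrier → Vec Carrier k → Set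
  l ∈F-span ls = ∃ λ gs → l ≡ linComb ls gs

  _∈F-span?_ : ∀ {k} l (ls : Vec Carrier k) → Dec (l ∈F-span ls)
  l ∈F-span? ls = ∃?-finiteVec F.enumeration _ (λ gs → l ≟ linComb ls gs)

  LinearlyIndependent : ∀ {k} → Vec Carrier k → Set
  LinearlyIndependent ls = ∀ fs → linComb ls fs ≡ 0# → All (_≡ F.0#) fs

  independent-[] : LinearlyIndependent []
  independent-[] [] _ = []

  independent-∷ : ∀ {k l} {ls : Vec Carrier k} →
                  ¬ l ∈F-span ls → LinearlyIndependent ls → LinearlyIndependent (l ∷ ls)
  independent-∷ {l = l} {ls} l∉span independent (f ∷ fs) f·l+L≡0 with f F.≟ F.0#
  ... | yes refl = refl ∷ independent fs (begin
    linComb ls fs               ≡⟨ solve 2 (λ x y → y := con 0 :* x :+ y) refl l (linComb ls fs) ⟩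
    0# * l + linComb ls fs      ≡⟨ cong (λ z → z * l + linComb ls fs) ι-0# ⟨
    ι F.0# * l + linComb ls fs  ≡⟨ f·l+L≡0 ⟩
    0#                          ∎)
  ... | no f≢0 with F.inverse f f≢0
  ... | h , fh≡1 = ⊥-elim (l∉span (map ((F.- h) F.*_) fs , sym solved))
    where
    L = linComb ls fs
    -- From ι f · l + L = 0 and f h = 1: ι (- h) · L = ι h · ι f · l = l.
    solved : linComb ls (map ((F.- h) F.*_) fs) ≡ l
    solved = begin
      linComb ls (map ((F.- h) F.*_) fs)     ≡⟨ linComb-map-*ʳ (F.- h) ls fs ⟩
      ι (F.- h) * L
        ≡⟨ solve 3 (λ x y z → x :* y := x :* y :+ z :* con 0) refl (ι (F.- h)) L (ι h) ⟩
      ι (F.- h) * L + ι h * 0#               ≡⟨ cong (λ z → ι (F.- h) * L + ι h * z) f·l+L≡0 ⟨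
      ι (F.- h) * L + ι h * (ι f * l + L)
        ≡⟨ solve 5 (λ a b c d e → a :* b :+ c :* (d :* e :+ b) := d :* c :* e :+ (a :+ c) :* b)
                 refl (ι (F.- h)) L (ι h) (ι f) l ⟩
      ι f * ι h * l + (ι (F.- h) + ι h) * L  ≡⟨ cong₂ (λ x y → x * l + y * L) (*-hom f h) (+-hom (F.- h) h) ⟨
      ι (f F.* h) * l + ι (F.- h F.+ h) * L  ≡⟨ cong₂ (λ x y → ι x * l + ι y * L) fh≡1 (FR.-‿inverseˡ h) ⟩
      ι F.1# * l + ι F.0# * L                ≡⟨ cong₂ (λ x y → x * l + y * L) 1-hom ι-0# ⟩
      1# * l + 0# * L                        ≡⟨ solve 2 (λ x y → con 1 :* x :+ con 0 :* y := x) refl l L ⟩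
      l                                      ∎

  module Code {n} (C : LinearCode F n) where
    open LinearCode C

    column : ∀ {k} → Vec (Word F n) k → Fin n → Vec F.Carrier k
    column cs i = map (λ c → lookup c i) cs

    -- Represents the word Σⱼ lⱼ ι(cⱼ) ∈ Kⁿ with every cⱼ ∈ C.
    record Combination : Set where
      constructor combination
      field
        {size}  : ℕ
        scalars : Vec Carrier size
        words   : Vec (Word F n) size
        words∈C : All _∈C words

      coordinate : Fin n → Carrier
      coordinate i = linComb scalars (column words i)

    open Combination

    addMultiple : Word F n → F.Carrier → Word F n → Word F n
    addMultiple c g c′ = zipWith F._+_ c′ (map (g F.*_) c)

    column-addMultiple : ∀ {k} c i (gs : Vec F.Carrier k) cs′ →
      column (zipWith (addMultiple c) gs cs′) i ≡ zipWith (λ f g → f F.+ g F.* lookup c i) (column cs′ i) gs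
    column-addMultiple c i []       []         = refl
    column-addMultiple c i (g ∷ gs) (c′ ∷ cs′) = cong₂ _∷_
      (trans (lookup-zipWith F._+_ i c′ _) (cong (lookup c′ i F.+_) (lookup-map i (g F.*_) c)))
      (column-addMultiple c i gs cs′)

    addMultiple-∈C : ∀ {k c} → c ∈C → (gs : Vec F.Carrier k) → ∀ {cs′} → All _∈C cs′ →
                     All _∈C (zipWith (addMultiple c) gs cs′)
    addMultiple-∈C c∈C []       []             = []
    addMultiple-∈C c∈C (g ∷ gs) (c′∈C ∷ cs′∈C) =
      add-∈ c′∈C (scale-∈ g c∈C) ∷ addMultiple-∈C c∈C gs cs′∈C

    -- Gaussian elimination over F: a scalar in the F-span of the later ones is
    -- absorbed by adding multiples of its word to theirs.
    independentCombination : ∀ {k} (ls : Vec Carrier k) {cs} → All _∈C cs →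
      ∃ λ φ → LinearlyIndependent (scalars φ) × (∀ i → coordinate φ i ≡ linComb ls (column cs i))
    independentCombination []       []          = combination [] [] [] , independent-[] , λ _ → refl
    independentCombination (l ∷ ls) {c ∷ cs} (c∈C ∷ cs∈C) with independentCombination ls cs∈C
    ... | combination ls′ cs′ cs′∈C , independent , same with l ∈F-span? ls′
    ... | no l∉span = combination (l ∷ ls′) (c ∷ cs′) (c∈C ∷ cs′∈C) , independent-∷ l∉span independent ,
                      λ i → cong (ι (lookup c i) * l +_) (same i)
    ... | yes (gs , l≡) = combination ls′ (zipWith (addMultiple c) gs cs′) (addMultiple-∈C c∈C gs cs′∈C) ,
                          independent , same′
      where
      same′ : ∀ i → linComb ls′ (column (zipWith (addMultiple c) gs cs′) i)
                    ≡ ι (lookup c i) * l + linComb ls (column cs i)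
      same′ i = begin
        linComb ls′ (column (zipWith (addMultiple c) gs cs′) i)
          ≡⟨ cong (linComb ls′) (column-addMultiple c i gs cs′) ⟩
        linComb ls′ (zipWith (λ f g → f F.+ g F.* lookup c i) (column cs′ i) gs)
          ≡⟨ linComb-axpy (lookup c i) ls′ (column cs′ i) gs ⟩
        linComb ls′ (column cs′ i) + ι (lookup c i) * linComb ls′ gs
          ≡⟨ cong₂ (λ x y → x + ι (lookup c i) * y) (same i) (sym l≡) ⟩
        linComb ls (column cs i) + ι (lookup c i) * l
          ≡⟨ KR.+-comm _ _ ⟩
        ι (lookup c i) * l + linComb ls (column cs i) ∎

    module Scaled (α : Word K n) where

      Expands : Combination → Word K n → Set
      Expands φ w = ∀ i → lookup w i ≡ coordinate φ i * lookup α i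

      lookup-ψ : ∀ c i → lookup (ψ F K ι α c) i ≡ ι (lookup c i) * lookup α i
      lookup-ψ c i = lookup-zipWith _ i c α

      𝒞⇒expansion : ∀ {w} → 𝒞 F K ι C α w → ∃ λ φ → Expands φ w
      𝒞⇒expansion span-zero =
        combination [] [] [] , λ i → trans (lookup-replicate i 0#) (sym (KR.zeroˡ _))
      𝒞⇒expansion (span-gen (c , c∈C , refl)) =
        combination (1# ∷ []) (c ∷ []) (c∈C ∷ []) , λ i → begin
          lookup (ψ F K ι α c) i                        ≡⟨ lookup-ψ c i ⟩
          ι (lookup c i) * lookup α i
            ≡⟨ cong (_* lookup α i) (solve 1 (λ x → x := x :* con 1 :+ con 0) refl _) ⟩
          (ι (lookup c i) * 1# + 0#) * lookup α i       ∎
      𝒞⇒expansion (span-add {u} {v} u∈𝒞 v∈𝒞) with 𝒞⇒expansion u∈𝒞 | 𝒞⇒expansion v∈𝒞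
      ... | combination ls cs cs∈C , u≡ | combination ls′ cs′ cs′∈C , v≡ =
        combination (ls ++ ls′) (cs ++ cs′) (++⁺ cs∈C cs′∈C) , λ i → begin
          lookup (zipWith _+_ u v) i
            ≡⟨ lookup-zipWith _+_ i u v ⟩
          lookup u i + lookup v i
            ≡⟨ cong₂ _+_ (u≡ i) (v≡ i) ⟩
          linComb ls (column cs i) * lookup α i + linComb ls′ (column cs′ i) * lookup α i
            ≡⟨ KR.distribʳ _ _ _ ⟨
          (linComb ls (column cs i) + linComb ls′ (column cs′ i)) * lookup α i
            ≡⟨ cong (_* lookup α i) (linComb-++ ls ls′ (column cs i) (column cs′ i)) ⟨
          linComb (ls ++ ls′) (column cs i ++ column cs′ i) * lookup α i
            ≡⟨ cong (λ fs → linComb (ls ++ ls′) fs * lookup α i) (map-++ (λ c → lookup c i) cs cs′) ⟨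
          linComb (ls ++ ls′) (column (cs ++ cs′) i) * lookup α i
            ∎
      𝒞⇒expansion (span-scale a {u} u∈𝒞) with 𝒞⇒expansion u∈𝒞
      ... | combination ls cs cs∈C , u≡ =
        combination (map (a *_) ls) cs cs∈C , λ i → begin
          lookup (map (a *_) u) i                          ≡⟨ lookup-map i (a *_) u ⟩
          a * lookup u i                                   ≡⟨ cong (a *_) (u≡ i) ⟩
          a * (linComb ls (column cs i) * lookup α i)      ≡⟨ KR.*-assoc _ _ _ ⟨
          a * linComb ls (column cs i) * lookup α i        ≡⟨ cong (_* lookup α i) (linComb-map-*ˡ a ls (column cs i)) ⟨
          linComb (map (a *_) ls) (column cs i) * lookup α i ∎

      expansion-allZero : ∀ {φ w} → Expands φ w → All (_≡ zeroWord F n) (words φ) → w ≡ zeroWord K n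
      expansion-allZero {combination ls cs _} {w} w≡ all≡0 = Pointwise-≡⇒≡ (ext λ i → begin
        lookup w i                             ≡⟨ w≡ i ⟩
        linComb ls (column cs i) * lookup α i  ≡⟨ cong (_* lookup α i) (linComb-zeros ls (column-zeros i)) ⟩
        0# * lookup α i                        ≡⟨ KR.zeroˡ _ ⟩
        0#                                     ≡⟨ lookup-replicate i 0# ⟨
        lookup (zeroWord K n) i                ∎)
        where
        column-zeros : ∀ i → All (_≡ F.0#) (column cs i)
        column-zeros i = map⁺ (All.map (λ { refl → lookup-replicate i F.0# }) all≡0)

      independentExpansion : ∀ {w} → 𝒞 F K ι C α w → ∃ λ φ → LinearlyIndependent (scalars φ) × Expands φ w
      independentExpansion w∈𝒞 with 𝒞⇒expansion w∈𝒞
      ... | φ , w≡ with independentCombination (scalars φ) (words∈C φ)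
      ... | φ′ , independent , same =
        φ′ , independent , λ i → trans (w≡ i) (cong (_* lookup α i) (sym (same i)))

      module NonzeroScaled (α≢0 : All (_≢ 0#) α) where

        ψ-zeros : ∀ c i → lookup (ψ F K ι α c) i ≡ 0# → lookup c i ≡ F.0#
        ψ-zeros c i ψᵢ≡0 with lookup c i F.≟ F.0#
        ... | yes cᵢ≡0 = cᵢ≡0
        ... | no cᵢ≢0  = ⊥-elim (ι-nonzero cᵢ≢0
                (x*y≡0⇒x≡0 (lookup⁺ α≢0 i) (trans (sym (lookup-ψ c i)) ψᵢ≡0)))

        zeros-ψ : ∀ c i → lookup c i ≡ F.0# → lookup (ψ F K ι α c) i ≡ 0#
        zeros-ψ c i cᵢ≡0 = begin
          lookup (ψ F K ι α c) i      ≡⟨ lookup-ψ c i ⟩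
          ι (lookup c i) * lookup α i ≡⟨ cong (λ x → ι x * lookup α i) cᵢ≡0 ⟩
          ι F.0# * lookup α i         ≡⟨ cong (_* lookup α i) ι-0# ⟩
          0# * lookup α i             ≡⟨ KR.zeroˡ _ ⟩
          0#                          ∎

        weight-ψ : ∀ c → weight K (ψ F K ι α c) ≡ weight F c
        weight-ψ c = ≤-antisym (weight-mono K F (ψ F K ι α c) c (zeros-ψ c))
                               (weight-mono F K c (ψ F K ι α c) (ψ-zeros c))

        ψ-nonzero : ∀ {c} → c ≢ zeroWord F n → ψ F K ι α c ≢ zeroWord K n
        ψ-nonzero {c} c≢0 = c≢0 ∘ zeroWord-mono F K c (ψ F K ι α c) (ψ-zeros c)

        expansion-zeros : ∀ {φ w} → LinearlyIndependent (scalars φ) → Expands φ w →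
                          ∀ i → lookup w i ≡ 0# → All (_≡ F.0#) (column (words φ) i)
        expansion-zeros independent w≡ i wᵢ≡0 =
          independent _ (x*y≡0⇒x≡0 (lookup⁺ α≢0 i) (trans (sym (w≡ i)) wᵢ≡0))

        nonzero-codeword-below : ∀ {w} → 𝒞 F K ι C α w → w ≢ zeroWord K n →
          ∃ λ c → c ∈C × c ≢ zeroWord F n × (∀ i → lookup w i ≡ 0# → lookup c i ≡ F.0#)
        nonzero-codeword-below {w} w∈𝒞 w≢0 with independentExpansion w∈𝒞
        ... | φ , independent , w≡ with all⊎any¬ (λ c → ≡-dec F._≟_ c (zeroWord F n)) (words φ)
        ... | inj₁ all≡0    = ⊥-elim (w≢0 (expansion-allZero {φ} w≡ all≡0))
        ... | inj₂ some≢0 with lookupAny (words∈C φ) some≢0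
        ... | c∈C , c≢0 = Any.lookup some≢0 , c∈C , c≢0 , λ i wᵢ≡0 →
          trans (sym (lookup-map j (λ c → lookup c i) (words φ)))
                (lookup⁺ (expansion-zeros {φ} {w} independent w≡ i wᵢ≡0) j)
          where j = Any.index some≢0

mainTheorem4 : ∀ (p k q m n : ℕ) → Prime p → 1 ≤ k → q ≡ p ^ k → n ≤ m →
    (F : FiniteField q) (K : FiniteField (q ^ m)) →
    (ι : FiniteField.Carrier F → FiniteField.Carrier K) → IsFieldHom F K ι →
    (C : LinearCode F n) (d : ℕ) → MinDist F (LinearCode._∈C C) d →
    (α : Vec (FiniteField.Carrier K) n) → All (λ a → a ≢ FiniteField.0# K) α →
    MinDist K (𝒞 F K ι C α) d
mainTheorem4 _ _ _ _ _ _ _ _ _ F K ι hom C d ((c , c∈C , c≢0 , ∣c∣≡d) , d≤weight) α α≢0 =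
  (ψ F K ι α c , span-gen (c , c∈C , refl) , ψ-nonzero c≢0 , trans (weight-ψ c) ∣c∣≡d) ,
  λ w w∈𝒞 w≢0 →
    let (c′ , c′∈C , c′≢0 , zeros) = nonzero-codeword-below w∈𝒞 w≢0
    in ≤-trans (d≤weight c′ c′∈C c′≢0) (weight-mono F K c′ w zeros)
  where open LinearCombinations.Code.Scaled.NonzeroScaled hom C α α≢0
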